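{- Let $\Gamma$, $\omega$, $\mathcal R$ be as in the context and let $\rho$ be a $2\to2$ fractional polymorphism of $\Gamma_c$ with $\mathrm{supp}(\rho)\subseteq\mathcal R$. Let $f\in\Gamma$ with $n=ar(f)$. Assume that $\rho$ is submodular on $\{a_1,a_2\}\subseteq D$ and that $(\bar x^1,\bar x^2)\in Range_{n-1}(\mathbf g)$ for some $\mathbf g\in\mathrm{supp}(\rho)$. Then $f^2((a_1,\bar x^1),(a_2,\bar x^2))=f^2((a_2,\bar x^1),(a_1,\bar x^2))$, where $f^2(\bar u,\bar v)=\frac12(f(\bar u)+f(\bar v))$ and $(a,\bar x)$ denotes the $n$-tuple with first entry $a$ followed by the entries of $\bar x$.
   Context: Setting: $D$ finite; $\Gamma$ a valued language on $D$ (a set of functions $f:D^m\to\mathbb{Q}_{\ge0}$) that is a core (every operation in the support of every unary fractional polymorphism of $\Gamma$ is injective); $\Gamma_c$ is obtained from $\Gamma$ by adding all functions obtained by fixing some variables of functions of $\Gamma$ to domain values; $\Gamma_c$ does not satisfy (MC), i.e. there are no distinct $a,b\in D$ and binary $h\in\langle\Gamma_c\rangle$ with $\arg\min h=\{(a,b),(b,a)\}$, where $\langle\Delta\rangle$ is the set of functions $f(x_1,\dots,x_m)=\min_{x_{m+1},\dots,x_n}\sum_iw_if_i(\bar x^i)$ with $f_i\in\Delta$, $w_i\in\mathbb{Q}_{\ge0}$. $\omega$ is a binary fractional polymorphism of $\Gamma_c$ such that for all distinct $a,b\in D$ there is $g\in\mathrm{supp}(\omega)$ with $\{g(a,b),g(b,a)\}\ne\{a,b\}$.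 Fractional polymorphisms: with $f^m(\bar a^1,\dots,\bar a^m)=\frac1m\sum_jf(\bar a^j)$, an $m$-ary one of $\Delta$ is $\omega:\{g:D^m\to D\}\to\mathbb{Q}_{\ge0}$, $\sum\omega=1$, $\sum_g\omega(g)f(g(\bar a^1,\dots,\bar a^m))\le f^m(\bar a^1,\dots,\bar a^m)$ for all $f\in\Delta$; a $2\to2$ one is $\rho:\{\mathbf g:D^2\to D^2\}\to\mathbb{Q}_{\ge0}$, $\sum\rho=1$, $\sum_{\mathbf g}\rho(\mathbf g)f^2(\mathbf g(\bar a^1,\bar a^2))\le f^2(\bar a^1,\bar a^2)$ for all $f\in\Delta$, $\bar a^1,\bar a^2\in D^{ar(f)}$ (componentwise application). supp = arguments with positive value. Construction: $\bar g(x,y)=g(y,x)$; for $\mathbf g=(g,\bar g):D^2\to D^2$ and binary $h$, $\mathbf g^h=(h\circ(g,\bar g),h\circ(\bar g,g))$; $\mathbf 1$ is the identity on $D^2$; $\mathcal V=\{\mathbf 1^{h_1\dots h_k}:k\ge0,h_i\in\mathrm{supp}(\omega)\}$; $G$ is the digraph on $\mathcal V$ with edges $(\mathbf g,\mathbf g^h)$, $h\in\mathrm{supp}(\omega)$; $\mathcal R$ is the set of $\mathbf g\in\mathcal V$ such that every vertex reachable from $\mathbf g$ in $G$ can reach $\mathbf g$. $Range_k(\mathbf g)=\{\mathbf g(\bar x^1,\bar x^2):\bar x^1,\bar x^2\in D^k\}$ (componentwise). For $a,b\in D$ let $w_a=\sum_{\mathbf g:\mathbf g(a,b)=(a,a)}\rho(\mathbf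 g)$ and $w_b=\sum_{\mathbf g:\mathbf g(a,b)=(b,b)}\rho(\mathbf g)$; $\rho$ is submodular on $\{a,b\}$ if $w_a=w_b=\frac12$. -}

module Defs where

open import Data.Nat using (ℕ; zero; suc; _+_)
open import Data.Fin using (Fin; _≟_)
open import Data.Vec using (Vec; []; _∷_; map; zipWith; lookup; _++_)
open import Data.List using (List; foldr)
open import Data.List.Relation.Unary.Any using (Any)
open import Data.List.Membership.Propositional using (_∈_)
open import Data.Maybe using (Maybe; just; nothing)
open import Data.Product using (Σ; ∃; _×_; _,_; proj₁; proj₂)
open import Data.Sum using (_⊎_)
open import Data.Rational using (ℚ; 0ℚ; 1ℚ; ½) renaming (_+_ to _+ℚ_; _*_ to _*ℚ_; _≤_ to _≤ℚ_; _<_ to _<ℚ_)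
open import Relation.Binary.PropositionalEquality using (_≡_; _≢_)
open import Relation.Nullary using (¬_; yes; no; Dec)
open import Function.Definitions using (Injective)

-- The domain D is Fin k.  A cost function of arity n is a map Vec D n → ℚ.
-- A valued language is a (possibly infinite) predicate on cost functions of every arity.

Lang : ℕ → Set₁
Lang k = (n : ℕ) → (Vec (Fin k) n → ℚ) → Set

NonNegLang : ∀ {k} → Lang k → Set
NonNegLang {k} Γ = ∀ n (f : Vec (Fin k) n → ℚ) → Γ n f → ∀ x → 0ℚ ≤ℚ f x

-- Γ_c : fixing some variables of functions of Γ to domain values.
-- A pattern p : Vec (Maybe D) n says which variables are fixed (just d)
-- and which remain free (nothing); the free ones keep their order.

holes : ∀ {k n} → Vec (Maybe (Fin k)) n → ℕ
holes [] = 0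
holes (nothing ∷ p) = suc (holes p)
holes (just _ ∷ p) = holes p

fill : ∀ {k n} (p : Vec (Maybe (Fin k)) n) → Vec (Fin k) (holes p) → Vec (Fin k) n
fill [] _ = []
fill (nothing ∷ p) (y ∷ ys) = y ∷ fill p ys
fill (just d ∷ p) ys = d ∷ fill p ys

data Const {k} (Γ : Lang k) : Lang k where
  fix : ∀ n (f : Vec (Fin k) n → ℚ) → Γ n f →
        (p : Vec (Maybe (Fin k)) n) →
        Const Γ (holes p) (λ y → f (fill p y))

sumW : ∀ {A : Set} → (A → ℚ) → List A → ℚ
sumW c = foldr (λ a r → c a +ℚ r) 0ℚ

IsDistr : ∀ {A : Set} → List (ℚ × A) → Set
IsDistr {A} ω = (∀ {e} → e ∈ ω → 0ℚ ≤ℚ proj₁ e) × (sumW proj₁ ω ≡ 1ℚ)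

InSupp : ∀ {A B : Set} → List (ℚ × (A → B)) → (A → B) → Set
InSupp ω g = Any (λ e → (0ℚ <ℚ proj₁ e) × (∀ x → proj₂ e x ≡ g x)) ω

UOp : ℕ → Set
UOp k = Fin k → Fin k

BOp : ℕ → Set
BOp k = Fin k → Fin k → Fin k

UnaryFP : ∀ {k} → Lang k → List (ℚ × UOp k) → Set
UnaryFP {k} Δ ν = IsDistr ν ×
  (∀ n f → Δ n f → ∀ (a : Vec (Fin k) n) →
     sumW (λ e → proj₁ e *ℚ f (map (proj₂ e) a)) ν ≤ℚ f a)

f² : ∀ {k n} → (Vec (Fin k) n → ℚ) → Vec (Fin k) n → Vec (Fin k) n → ℚ
f² f u v = ½ *ℚ (f u +ℚ f v)

BinaryFP : ∀ {k} → Lang k → List (ℚ × BOp k) → Set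
BinaryFP {k} Δ ω = IsDistr ω ×
  (∀ n f → Δ n f → ∀ (a b : Vec (Fin k) n) →
     sumW (λ e → proj₁ e *ℚ f (zipWith (proj₂ e) a b)) ω ≤ℚ f² f a b)

InSuppB : ∀ {k} → List (ℚ × BOp k) → BOp k → Set
InSuppB ω g = Any (λ e → (0ℚ <ℚ proj₁ e) × (∀ x y → proj₂ e x y ≡ g x y)) ω

-- maps D² → D², given by their two component binary operations
Op22 : ℕ → Set
Op22 k = BOp k × BOp k

app22 : ∀ {k n} → Op22 k → Vec (Fin k) n → Vec (Fin k) n → Vec (Fin k) n × Vec (Fin k) n
app22 (g₁ , g₂) a b = zipWith g₁ a b , zipWith g₂ a b

TwoToTwoFP : ∀ {k} → Lang k → List (ℚ × Op22 k) → Set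
TwoToTwoFP {k} Δ ρ = IsDistr ρ ×
  (∀ n f → Δ n f → ∀ (a b : Vec (Fin k) n) →
     sumW (λ e → proj₁ e *ℚ f² f (proj₁ (app22 (proj₂ e) a b)) (proj₂ (app22 (proj₂ e) a b))) ρ
       ≤ℚ f² f a b)

InSupp22 : ∀ {k} → List (ℚ × Op22 k) → Op22 k → Set
InSupp22 ρ 𝐠 = Any (λ e → (0ℚ <ℚ proj₁ e) ×
  (∀ x y → proj₁ (proj₂ e) x y ≡ proj₁ 𝐠 x y × proj₂ (proj₂ e) x y ≡ proj₂ 𝐠 x y)) ρ

IsCore : ∀ {k} → Lang k → Set
IsCore {k} Γ = ∀ (ν : List (ℚ × UOp k)) → UnaryFP Γ ν →
  ∀ g → InSupp ν g → Injective _≡_ _≡_ g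

record Atom {k} (Δ : Lang k) (N : ℕ) : Set where
  field
    ar    : ℕ
    fn    : Vec (Fin k) ar → ℚ
    inΔ   : Δ ar fn
    wt    : ℚ
    wt≥0  : 0ℚ ≤ℚ wt
    scope : Vec (Fin N) ar

gadgetValue : ∀ {k N} {Δ : Lang k} → List (Atom Δ N) → Vec (Fin k) N → ℚ
gadgetValue as z = sumW (λ A → Atom.wt A *ℚ Atom.fn A (map (lookup z) (Atom.scope A))) as

-- h ∈ ⟨Δ⟩ : h(x) = min_y Σ_i w_i f_i(...) over extra variables y
Expressible : ∀ {k} → Lang k → (m : ℕ) → (Vec (Fin k) m → ℚ) → Set
Expressible {k} Δ m h = Σ ℕ λ e → Σ (List (Atom Δ (m + e))) λ as →
  ∀ (x : Vec (Fin k) m) →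
    (Σ (Vec (Fin k) e) λ y → gadgetValue as (x ++ y) ≡ h x) ×
    (∀ (y : Vec (Fin k) e) → h x ≤ℚ gadgetValue as (x ++ y))

IsArgMin : ∀ {k m} → (Vec (Fin k) m → ℚ) → Vec (Fin k) m → Set
IsArgMin h x = ∀ y → h x ≤ℚ h y

MC : ∀ {k} → Lang k → Set
MC {k} Δ = Σ (Fin k) λ a → Σ (Fin k) λ b → a ≢ b ×
  Σ (Vec (Fin k) 2 → ℚ) λ h → Expressible Δ 2 h ×
    (∀ x → (IsArgMin h x → (x ≡ a ∷ b ∷ []) ⊎ (x ≡ b ∷ a ∷ [])) ×
           ((x ≡ a ∷ b ∷ []) ⊎ (x ≡ b ∷ a ∷ []) → IsArgMin h x))

SameSet2 : ∀ {k} → Fin k → Fin k → Fin k → Fin k → Set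
SameSet2 c d a b = (c ≡ a ⊎ c ≡ b) × (d ≡ a ⊎ d ≡ b) × (a ≡ c ⊎ a ≡ d) × (b ≡ c ⊎ b ≡ d)

𝟏 : ∀ {k} → Op22 k
𝟏 = (λ x y → x) , (λ x y → y)

_^_ : ∀ {k} → Op22 k → BOp k → Op22 k
(g₁ , g₂) ^ h = (λ x y → h (g₁ x y) (g₂ x y)) , (λ x y → h (g₂ x y) (g₁ x y))

_≈₂₂_ : ∀ {k} → Op22 k → Op22 k → Set
𝐠 ≈₂₂ 𝐠' = ∀ x y → proj₁ 𝐠 x y ≡ proj₁ 𝐠' x y × proj₂ 𝐠 x y ≡ proj₂ 𝐠' x y

-- 𝐠' reachable from 𝐠 in G (vertices up to extensional equality)
data Reach {k} (ω : List (ℚ × BOp k)) : Op22 k → Op22 k → Set where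
  here : ∀ {𝐠 𝐠'} → 𝐠 ≈₂₂ 𝐠' → Reach ω 𝐠 𝐠'
  step : ∀ {𝐠 𝐠'} h → InSuppB ω h → Reach ω (𝐠 ^ h) 𝐠' → Reach ω 𝐠 𝐠'

InV : ∀ {k} → List (ℚ × BOp k) → Op22 k → Set
InV ω 𝐠 = Reach ω 𝟏 𝐠

InR : ∀ {k} → List (ℚ × BOp k) → Op22 k → Set
InR ω 𝐠 = InV ω 𝐠 × (∀ 𝐠' → Reach ω 𝐠 𝐠' → Reach ω 𝐠' 𝐠)

InRange : ∀ {k m} → Op22 k → Vec (Fin k) m → Vec (Fin k) m → Set
InRange {k} {m} 𝐠 x₁ x₂ = Σ (Vec (Fin k) m) λ y₁ → Σ (Vec (Fin k) m) λ y₂ →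
  app22 𝐠 y₁ y₂ ≡ (x₁ , x₂)

weightWhere : ∀ {k} → Fin k → Fin k → Fin k → List (ℚ × Op22 k) → ℚ
weightWhere a b c = sumW λ e → sel (proj₁ (proj₂ e) a b ≟ c) (proj₂ (proj₂ e) a b ≟ c) (proj₁ e)
  where
  sel : ∀ {P Q : Set} → Dec P → Dec Q → ℚ → ℚ
  sel (yes _) (yes _) w = w
  sel _ _ w = 0ℚ

SubmodularOn : ∀ {k} → List (ℚ × Op22 k) → Fin k → Fin k → Set
SubmodularOn ρ a b = weightWhere a b a ρ ≡ ½ × weightWhere a b b ρ ≡ ½

-- For c ∈ D and a preimage ȳ of (x̄¹, x̄²) under 𝐠 consider the potential
-- Φ_c(𝐯) = f²((c, 𝐯₁(ȳ)), (c, 𝐯₂(ȳ))) on the vertices 𝐯 of G.  Fixing the first argument of f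
-- to c gives a function of Γ_c, so ω makes Φ_c superharmonic along the edges of G; as Φ_c takes
-- finitely many values it is minimal on the class of every recurrent vertex, in particular at
-- 𝐠 ∈ 𝓡.  For 𝐡 ∈ supp ρ with 𝐡(a₁,a₂) = (c,c) the vertex 𝐡 ∘ 𝐠 is reachable from 𝐠, so the
-- term of 𝐡 in the ρ-average of f² at ((a₁,x̄¹),(a₂,x̄²)) is at least Φ_c(𝐠); as vertices of G
-- commute with swapping the arguments, the same holds at ((a₂,x̄¹),(a₁,x̄²)).  Submodularity puts
-- weight ½ on c = a₁ and on c = a₂, so both averages are at least the mean of the two values of
-- f², while ρ bounds each average by its own value: the two values coincide.
module Submission where

open import Defs
open import Data.Nat using (ℕ; zero; suc; s≤s) renaming (_<_ to _<ℕ_; _≤_ to _≤ℕ_)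
import Data.Nat.Properties as ℕ
open import Data.Nat.Induction using (<-wellFounded)
open import Data.Fin using (Fin; _≟_)
open import Data.Maybe using (Maybe; nothing; just)
open import Data.Vec using (Vec; []; _∷_; zipWith; replicate)
open import Data.List using (List; []; _∷_; allFin; cartesianProductWith; cartesianProduct; map)
open import Data.List.Relation.Unary.Any using (here; there)
import Data.List.Relation.Unary.Any as Any
open import Data.List.Membership.Propositional using (_∈_; find)
open import Data.List.Membership.Propositional.Properties
  using (∈-allFin; ∈-cartesianProductWith⁺; ∈-cartesianProduct⁺; ∈-map⁺)
open import Data.Product using (Σ; _×_; _,_; proj₁; proj₂)
open import Data.Rational using (ℚ; 0ℚ; 1ℚ; ½; _+_; _*_; -_; _≤_; _<_; nonNegative; positive)
open import Data.Rational.Properties hiding (_≟_)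
open import Data.Rational.Solver using (module +-*-Solver)
open import Data.Empty using (⊥-elim)
open import Induction.WellFounded using (module All)
import Relation.Binary.Construct.On as On
open import Relation.Binary.PropositionalEquality
open import Relation.Nullary using (¬_; yes; no)
open import Relation.Nullary.Decidable using (_×-dec_)

open +-*-Solver

*-monoˡ-≤-onSupport : ∀ w {p q} → 0ℚ ≤ w → (0ℚ < w → p ≤ q) → w * p ≤ w * q
*-monoˡ-≤-onSupport w {p} {q} 0≤w p≤q with 0ℚ <? w
... | yes 0<w = *-monoˡ-≤-nonNeg w {{nonNegative 0≤w}} (p≤q 0<w)
... | no 0≮w rewrite ≤-antisym (≮⇒≥ 0≮w) 0≤w = ≤-reflexive (trans (*-zeroˡ p) (sym (*-zeroˡ q)))

+-cancelʳ-≤ : ∀ r {p q} → p + r ≤ q + r → p ≤ q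
+-cancelʳ-≤ r {p} {q} p+r≤q+r = subst₂ _≤_ (cancel p) (cancel q) (+-monoˡ-≤ (- r) p+r≤q+r)
  where
  cancel : ∀ x → x + r + - r ≡ x
  cancel x = solve 2 (λ x r → x :+ r :+ :- r := x) refl x r

+-cancelˡ-≤ : ∀ r {p q} → r + p ≤ r + q → p ≤ q
+-cancelˡ-≤ r {p} {q} r+p≤r+q = +-cancelʳ-≤ r (subst₂ _≤_ (+-comm r p) (+-comm r q) r+p≤r+q)

mean≤ˡ⇒≤ : ∀ p q → ½ * (p + q) ≤ p → q ≤ p
mean≤ˡ⇒≤ p q mean≤p = +-cancelʳ-≤ p (begin
  q + p                          ≡⟨ solve 2 (λ p q → q :+ p := con ½ :* (p :+ q) :+ con ½ :* (p :+ q)) refl p q ⟩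
  ½ * (p + q) + ½ * (p + q)      ≤⟨ +-mono-≤ mean≤p mean≤p ⟩
  p + p                          ∎)
  where open ≤-Reasoning

mean≤both⇒≡ : ∀ p q → ½ * (p + q) ≤ p → ½ * (p + q) ≤ q → p ≡ q
mean≤both⇒≡ p q mean≤p mean≤q =
  ≤-antisym (mean≤ˡ⇒≤ q p (subst (_≤ q) (cong (½ *_) (+-comm p q)) mean≤q)) (mean≤ˡ⇒≤ p q mean≤p)

module _ {A : Set} where

  sumW-cong : ∀ {c d : A → ℚ} l → (∀ {e} → e ∈ l → c e ≡ d e) → sumW c l ≡ sumW d l
  sumW-cong []      c≡d = refl
  sumW-cong (x ∷ l) c≡d = cong₂ _+_ (c≡d (here refl)) (sumW-cong l (λ e∈l → c≡d (there e∈l)))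

  sumW-mono : ∀ {c d : A → ℚ} l → (∀ {e} → e ∈ l → c e ≤ d e) → sumW c l ≤ sumW d l
  sumW-mono []      c≤d = ≤-refl
  sumW-mono (x ∷ l) c≤d = +-mono-≤ (c≤d (here refl)) (sumW-mono l (λ e∈l → c≤d (there e∈l)))

  sumW-+ : ∀ (c d : A → ℚ) l → sumW (λ e → c e + d e) l ≡ sumW c l + sumW d l
  sumW-+ c d []      = sym (+-identityˡ 0ℚ)
  sumW-+ c d (x ∷ l) rewrite sumW-+ c d l =
    solve 4 (λ a b s t → (a :+ b) :+ (s :+ t) := (a :+ s) :+ (b :+ t)) refl (c x) (d x) (sumW c l) (sumW d l)

  sumW-*ʳ : ∀ (c : A → ℚ) r l → sumW (λ e → c e * r) l ≡ sumW c l * r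
  sumW-*ʳ c r []      = sym (*-zeroˡ r)
  sumW-*ʳ c r (x ∷ l) rewrite sumW-*ʳ c r l = sym (*-distribʳ-+ r (c x) (sumW c l))

  sumW-*ˡ : ∀ (c : A → ℚ) r l → sumW (λ e → r * c e) l ≡ r * sumW c l
  sumW-*ˡ c r []      = sym (*-zeroʳ r)
  sumW-*ˡ c r (x ∷ l) rewrite sumW-*ˡ c r l = sym (*-distribˡ-+ r (c x) (sumW c l))

  sumW-tight : ∀ {c d : A → ℚ} l → (∀ {e} → e ∈ l → d e ≤ c e) → sumW c l ≤ sumW d l →
               ∀ {e} → e ∈ l → c e ≤ d e
  sumW-tight {c} {d} (x ∷ l) d≤c Σc≤Σd (here refl) = +-cancelʳ-≤ (sumW d l) (begin
    c x + sumW d l  ≤⟨ +-monoʳ-≤ (c x) (sumW-mono l (λ e∈l → d≤c (there e∈l))) ⟩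
    c x + sumW c l  ≤⟨ Σc≤Σd ⟩
    d x + sumW d l  ∎)
    where open ≤-Reasoning
  sumW-tight {c} {d} (x ∷ l) d≤c Σc≤Σd (there e∈l) =
    sumW-tight l (λ e∈l → d≤c (there e∈l)) (+-cancelˡ-≤ (c x) (begin
      c x + sumW c l  ≤⟨ Σc≤Σd ⟩
      d x + sumW d l  ≤⟨ +-monoˡ-≤ (sumW d l) (d≤c (here refl)) ⟩
      c x + sumW d l  ∎)) e∈l
    where open ≤-Reasoning

countBelow : ℚ → List ℚ → ℕ
countBelow r []      = 0
countBelow r (x ∷ l) with x <? r
... | yes _ = suc (countBelow r l)
... | no  _ = countBelow r l

countBelow-mono : ∀ {r s} → r ≤ s → ∀ l → countBelow r l ≤ℕ countBelow s l
countBelow-mono r≤s []      = ℕ.≤-refl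
countBelow-mono {r} {s} r≤s (x ∷ l) with x <? r | x <? s
... | yes _   | yes _   = s≤s (countBelow-mono r≤s l)
... | yes x<r | no  x≮s = ⊥-elim (x≮s (<-≤-trans x<r r≤s))
... | no  _   | yes _   = ℕ.m≤n⇒m≤1+n (countBelow-mono r≤s l)
... | no  _   | no  _   = countBelow-mono r≤s l

countBelow-strict : ∀ {r s} → r < s → ∀ {l} → r ∈ l → countBelow r l <ℕ countBelow s l
countBelow-strict {r} {s} r<s {x ∷ l} (here refl) with r <? r | r <? s
... | yes r<r | _       = ⊥-elim (<-irrefl refl r<r)
... | no  _   | yes _   = s≤s (countBelow-mono (<⇒≤ r<s) l)
... | no  _   | no  r≮s = ⊥-elim (r≮s r<s)
countBelow-strict {r} {s} r<s {x ∷ l} (there r∈l) with x <? r | x <? s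
... | yes _   | yes _   = s≤s (countBelow-strict r<s r∈l)
... | yes x<r | no  x≮s = ⊥-elim (x≮s (<-trans x<r r<s))
... | no  _   | yes _   = ℕ.m<n⇒m<1+n (countBelow-strict r<s r∈l)
... | no  _   | no  _   = countBelow-strict r<s r∈l

allVec : ∀ k m → List (Vec (Fin k) m)
allVec k zero    = [] ∷ []
allVec k (suc m) = cartesianProductWith _∷_ (allFin k) (allVec k m)

∈-allVec : ∀ {k m} (x : Vec (Fin k) m) → x ∈ allVec k m
∈-allVec []       = here refl
∈-allVec (x ∷ xs) = ∈-cartesianProductWith⁺ _∷_ (∈-allFin x) (∈-allVec xs)

module _ {k : ℕ} where

  zipWith-cong : ∀ {n} {g h : BOp k} → (∀ x y → g x y ≡ h x y) →
                 (u v : Vec (Fin k) n) → zipWith g u v ≡ zipWith h u v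
  zipWith-cong g≡h []       []       = refl
  zipWith-cong g≡h (x ∷ u) (y ∷ v) = cong₂ _∷_ (g≡h x y) (zipWith-cong g≡h u v)

  zipWith-fuse : ∀ {n} (h g₁ g₂ : BOp k) (u v : Vec (Fin k) n) →
                 zipWith (λ x y → h (g₁ x y) (g₂ x y)) u v ≡ zipWith h (zipWith g₁ u v) (zipWith g₂ u v)
  zipWith-fuse h g₁ g₂ []       []       = refl
  zipWith-fuse h g₁ g₂ (x ∷ u) (y ∷ v) = cong (_ ∷_) (zipWith-fuse h g₁ g₂ u v)

_∘₂_ : ∀ {k} → Op22 k → Op22 k → Op22 k
(h₁ , h₂) ∘₂ (g₁ , g₂) = (λ x y → h₁ (g₁ x y) (g₂ x y)) , (λ x y → h₂ (g₁ x y) (g₂ x y))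

Recurrent : ∀ {k} → List (ℚ × BOp k) → Op22 k → Set
Recurrent ω 𝐬 = ∀ 𝐭 → Reach ω 𝐬 𝐭 → Reach ω 𝐭 𝐬

SwapInvariant : ∀ {k} → Op22 k → Set
SwapInvariant 𝐯 = ∀ x y → proj₂ 𝐯 x y ≡ proj₁ 𝐯 y x

module _ {k : ℕ} {ω : List (ℚ × BOp k)} where

  ≈₂₂-trans : ∀ {𝐮 𝐯 𝐰 : Op22 k} → 𝐮 ≈₂₂ 𝐯 → 𝐯 ≈₂₂ 𝐰 → 𝐮 ≈₂₂ 𝐰
  ≈₂₂-trans 𝐮≈𝐯 𝐯≈𝐰 x y =
    trans (proj₁ (𝐮≈𝐯 x y)) (proj₁ (𝐯≈𝐰 x y)) , trans (proj₂ (𝐮≈𝐯 x y)) (proj₂ (𝐯≈𝐰 x y))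

  ^-cong : ∀ {𝐮 𝐯 : Op22 k} h → 𝐮 ≈₂₂ 𝐯 → (𝐮 ^ h) ≈₂₂ (𝐯 ^ h)
  ^-cong h 𝐮≈𝐯 x y =
    cong₂ h (proj₁ (𝐮≈𝐯 x y)) (proj₂ (𝐮≈𝐯 x y)) , cong₂ h (proj₂ (𝐮≈𝐯 x y)) (proj₁ (𝐮≈𝐯 x y))

  Reach-respˡ-≈ : ∀ {𝐮 𝐯 𝐰} → 𝐮 ≈₂₂ 𝐯 → Reach ω 𝐯 𝐰 → Reach ω 𝐮 𝐰
  Reach-respˡ-≈ 𝐮≈𝐯 (here 𝐯≈𝐰)    = here (≈₂₂-trans 𝐮≈𝐯 𝐯≈𝐰)
  Reach-respˡ-≈ 𝐮≈𝐯 (step h h∈ω r) = step h h∈ω (Reach-respˡ-≈ (^-cong h 𝐮≈𝐯) r)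

  Reach-trans : ∀ {𝐮 𝐯 𝐰} → Reach ω 𝐮 𝐯 → Reach ω 𝐯 𝐰 → Reach ω 𝐮 𝐰
  Reach-trans (here 𝐮≈𝐯)    r = Reach-respˡ-≈ 𝐮≈𝐯 r
  Reach-trans (step h h∈ω r) r′ = step h h∈ω (Reach-trans r r′)

  -- (𝐮 ∘₂ 𝐠) ^ h is definitionally (𝐮 ^ h) ∘₂ 𝐠.
  Reach-∘₂ʳ : ∀ {𝐮 𝐯} 𝐠 → Reach ω 𝐮 𝐯 → Reach ω (𝐮 ∘₂ 𝐠) (𝐯 ∘₂ 𝐠)
  Reach-∘₂ʳ 𝐠 (here 𝐮≈𝐯)    = here (λ x y → 𝐮≈𝐯 _ _)
  Reach-∘₂ʳ 𝐠 (step h h∈ω r) = step h h∈ω (Reach-∘₂ʳ 𝐠 r)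

  Recurrent-reach : ∀ {𝐬 𝐭} → Recurrent ω 𝐬 → Reach ω 𝐬 𝐭 → Recurrent ω 𝐭
  Recurrent-reach rec 𝐬→𝐭 𝐮 𝐭→𝐮 = Reach-trans (rec 𝐮 (Reach-trans 𝐬→𝐭 𝐭→𝐮)) 𝐬→𝐭

  Reach-swapInvariant : ∀ {𝐮 𝐯} → SwapInvariant 𝐮 → Reach ω 𝐮 𝐯 → SwapInvariant 𝐯
  Reach-swapInvariant sw (here 𝐮≈𝐯) x y = trans (sym (proj₂ (𝐮≈𝐯 x y))) (trans (sw x y) (proj₁ (𝐮≈𝐯 y x)))
  Reach-swapInvariant sw (step h h∈ω r) = Reach-swapInvariant (λ x y → cong₂ h (sw x y) (sym (sw y x))) r

  InV⇒swapInvariant : ∀ {𝐯} → InV ω 𝐯 → SwapInvariant 𝐯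
  InV⇒swapInvariant = Reach-swapInvariant (λ x y → refl)

DiagonalAgrees : ∀ {k} → List (ℚ × BOp k) → (a b u v : Fin k) → Set
DiagonalAgrees {k} ω a b u v = ∀ {𝐡 : Op22 k} {c} → InV ω 𝐡 →
  proj₁ 𝐡 a b ≡ c → proj₂ 𝐡 a b ≡ c → proj₁ 𝐡 u v ≡ c × proj₂ 𝐡 u v ≡ c

DiagonalAgrees-swap : ∀ {k} {ω : List (ℚ × BOp k)} {a b} → DiagonalAgrees ω a b b a
DiagonalAgrees-swap {a = a} {b} 𝐡∈V h₁≡c h₂≡c =
  trans (sym (sw a b)) h₂≡c , trans (sw b a) h₁≡c
  where sw = InV⇒swapInvariant 𝐡∈V

BinaryFPOf : ∀ {k n} → List (ℚ × BOp k) → (Vec (Fin k) n → ℚ) → Set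
BinaryFPOf {k} {n} ω φ = ∀ (u v : Vec (Fin k) n) →
  sumW (λ e → proj₁ e * φ (zipWith (proj₂ e) u v)) ω ≤ f² φ u v

TwoToTwoFPOf : ∀ {k n} → List (ℚ × Op22 k) → (Vec (Fin k) n → ℚ) → Set
TwoToTwoFPOf {k} {n} ρ φ = ∀ (u v : Vec (Fin k) n) →
  sumW (λ e → proj₁ e * f² φ (zipWith (proj₁ (proj₂ e)) u v) (zipWith (proj₂ (proj₂ e)) u v)) ρ ≤ f² φ u v

module _ {k : ℕ} where

  private
    allFree : ∀ n → Vec (Maybe (Fin k)) n
    allFree n = replicate n nothing

  -- holes (allFree n) equals n only propositionally, hence the transport toHoles.
  toHoles : ∀ {n} → Vec (Fin k) n → Vec (Fin k) (holes (allFree n))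
  toHoles []       = []
  toHoles (x ∷ xs) = x ∷ toHoles xs

  fill-toHoles : ∀ {n} (x : Vec (Fin k) n) → fill (allFree n) (toHoles x) ≡ x
  fill-toHoles []       = refl
  fill-toHoles (x ∷ xs) = cong (x ∷_) (fill-toHoles xs)

  fill-zipWith-toHoles : ∀ {n} (h : BOp k) (u v : Vec (Fin k) n) →
                         fill (allFree n) (zipWith h (toHoles u) (toHoles v)) ≡ zipWith h u v
  fill-zipWith-toHoles h []       []       = refl
  fill-zipWith-toHoles h (x ∷ u) (y ∷ v) = cong (h x y ∷_) (fill-zipWith-toHoles h u v)

  BinaryFP⇒fixHead : ∀ {Γ : Lang k} {ω m f} → BinaryFP (Const Γ) ω → Γ (suc m) f →
                     ∀ c → BinaryFPOf ω (λ x → f (c ∷ x))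
  BinaryFP⇒fixHead {ω = ω} {m} {f} ωFP f∈Γ c u v =
    subst₂ _≤_ (sumW-cong ω (λ {e} _ → cong (λ z → proj₁ e * f (c ∷ z)) (fill-zipWith-toHoles (proj₂ e) u v)))
               (cong₂ (λ p q → f² f (c ∷ p) (c ∷ q)) (fill-toHoles u) (fill-toHoles v))
      (proj₂ ωFP _ _ (fix (suc m) f f∈Γ (just c ∷ allFree m)) (toHoles u) (toHoles v))

  TwoToTwoFP⇒of : ∀ {Γ : Lang k} {ρ n f} → TwoToTwoFP (Const Γ) ρ → Γ n f → TwoToTwoFPOf ρ f
  TwoToTwoFP⇒of {ρ = ρ} {n} {f} ρFP f∈Γ u v =
    subst₂ _≤_ (sumW-cong ρ (λ {e} _ → cong₂ (λ p q → proj₁ e * f² f p q)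
                                              (fill-zipWith-toHoles (proj₁ (proj₂ e)) u v)
                                              (fill-zipWith-toHoles (proj₂ (proj₂ e)) u v)))
               (cong₂ (f² f) (fill-toHoles u) (fill-toHoles v))
      (proj₂ ρFP _ _ (fix n f f∈Γ (allFree n)) (toHoles u) (toHoles v))

module Potential {k m : ℕ} (ω : List (ℚ × BOp k)) (ω-distr : IsDistr ω)
  (φ : Vec (Fin k) m → ℚ) (ω-fp : BinaryFPOf ω φ) (y₁ y₂ : Vec (Fin k) m) where

  Φ : Op22 k → ℚ
  Φ 𝐯 = f² φ (zipWith (proj₁ 𝐯) y₁ y₂) (zipWith (proj₂ 𝐯) y₁ y₂)

  Φ-cong : ∀ {𝐮 𝐯} → 𝐮 ≈₂₂ 𝐯 → Φ 𝐮 ≡ Φ 𝐯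
  Φ-cong 𝐮≈𝐯 = cong₂ (f² φ) (zipWith-cong (λ x y → proj₁ (𝐮≈𝐯 x y)) y₁ y₂)
                            (zipWith-cong (λ x y → proj₂ (𝐮≈𝐯 x y)) y₁ y₂)

  Φ-superharmonic : ∀ 𝐯 → sumW (λ e → proj₁ e * Φ (𝐯 ^ proj₂ e)) ω ≤ Φ 𝐯
  Φ-superharmonic 𝐯 = begin
    sumW (λ e → proj₁ e * Φ (𝐯 ^ proj₂ e)) ω
      ≡⟨ sumW-cong ω (λ {e} _ → split e) ⟩
    sumW (λ e → ½ * F p q e + ½ * F q p e) ω
      ≡⟨ sumW-+ (λ e → ½ * F p q e) (λ e → ½ * F q p e) ω ⟩
    sumW (λ e → ½ * F p q e) ω + sumW (λ e → ½ * F q p e) ω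
      ≡⟨ cong₂ _+_ (sumW-*ˡ (F p q) ½ ω) (sumW-*ˡ (F q p) ½ ω) ⟩
    ½ * sumW (F p q) ω + ½ * sumW (F q p) ω
      ≤⟨ +-mono-≤ (*-monoˡ-≤-nonNeg ½ (ω-fp p q)) (*-monoˡ-≤-nonNeg ½ (ω-fp q p)) ⟩
    ½ * f² φ p q + ½ * f² φ q p
      ≡⟨ solve 2 (λ s t → con ½ :* (con ½ :* (s :+ t)) :+ con ½ :* (con ½ :* (t :+ s)) := con ½ :* (s :+ t))
                 refl (φ p) (φ q) ⟩
    Φ 𝐯 ∎
    where
    open ≤-Reasoning
    p = zipWith (proj₁ 𝐯) y₁ y₂
    q = zipWith (proj₂ 𝐯) y₁ y₂
    F : Vec (Fin k) m → Vec (Fin k) m → ℚ × BOp k → ℚ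
    F u v e = proj₁ e * φ (zipWith (proj₂ e) u v)
    split : ∀ e → proj₁ e * Φ (𝐯 ^ proj₂ e) ≡ ½ * F p q e + ½ * F q p e
    split (w , h) = trans
      (cong (λ z → w * z) (cong₂ (f² φ) (zipWith-fuse h (proj₁ 𝐯) (proj₂ 𝐯) y₁ y₂)
                                          (zipWith-fuse h (proj₂ 𝐯) (proj₁ 𝐯) y₁ y₂)))
      (solve 3 (λ w s t → w :* (con ½ :* (s :+ t)) := con ½ :* (w :* s) :+ con ½ :* (w :* t))
             refl w (φ (zipWith h p q)) (φ (zipWith h q p)))

  MinimalAt : Op22 k → Set
  MinimalAt 𝐬 = ∀ 𝐮 → Reach ω 𝐬 𝐮 → Φ 𝐬 ≤ Φ 𝐮

  Φ-^-minimal : ∀ {𝐬 h} → MinimalAt 𝐬 → InSuppB ω h → Φ (𝐬 ^ h) ≡ Φ 𝐬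
  Φ-^-minimal {𝐬} {h} min h∈ω = ≤-antisym Φ𝐬^h≤Φ𝐬 (min _ (step h h∈ω (here λ x y → refl , refl)))
    where
    c d : ℚ × BOp k → ℚ
    c e = proj₁ e * Φ (𝐬 ^ proj₂ e)
    d e = proj₁ e * Φ 𝐬
    d≤c : ∀ {e} → e ∈ ω → d e ≤ c e
    d≤c {w , g} e∈ω = *-monoˡ-≤-onSupport w (proj₁ ω-distr e∈ω) λ 0<w →
      min _ (step g (Any.map (λ { refl → 0<w , λ x y → refl }) e∈ω) (here λ x y → refl , refl))
    Σc≤Σd : sumW c ω ≤ sumW d ω
    Σc≤Σd = ≤-trans (Φ-superharmonic 𝐬) (≤-reflexive (sym (begin
      sumW d ω         ≡⟨ sumW-*ʳ proj₁ (Φ 𝐬) ω ⟩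
      sumW proj₁ ω * Φ 𝐬 ≡⟨ cong (_* Φ 𝐬) (proj₂ ω-distr) ⟩
      1ℚ * Φ 𝐬         ≡⟨ *-identityˡ (Φ 𝐬) ⟩
      Φ 𝐬              ∎)))
      where open ≡-Reasoning
    Φ𝐬^h≤Φ𝐬 : Φ (𝐬 ^ h) ≤ Φ 𝐬
    Φ𝐬^h≤Φ𝐬 with find h∈ω
    ... | (w , g) , e∈ω , 0<w , g≡h =
      subst (_≤ Φ 𝐬) (Φ-cong (λ x y → g≡h _ _ , g≡h _ _))
        (*-cancelˡ-≤-pos w {{positive 0<w}} (sumW-tight ω d≤c Σc≤Σd e∈ω))

  Φ-reach-minimal : ∀ {𝐬 𝐯} → MinimalAt 𝐬 → Reach ω 𝐬 𝐯 → Φ 𝐯 ≡ Φ 𝐬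
  Φ-reach-minimal       min (here 𝐬≈𝐯)        = sym (Φ-cong 𝐬≈𝐯)
  Φ-reach-minimal {𝐬} min (step h h∈ω 𝐬^h→𝐯) = trans (Φ-reach-minimal min^h 𝐬^h→𝐯) Φ𝐬^h≡Φ𝐬
    where
    Φ𝐬^h≡Φ𝐬 : Φ (𝐬 ^ h) ≡ Φ 𝐬
    Φ𝐬^h≡Φ𝐬 = Φ-^-minimal min h∈ω
    min^h : MinimalAt (𝐬 ^ h)
    min^h 𝐮 r = subst (_≤ Φ 𝐮) (sym Φ𝐬^h≡Φ𝐬) (min 𝐮 (step h h∈ω r))

  values : List ℚ
  values = map (λ (p , q) → f² φ p q) (cartesianProduct (allVec k m) (allVec k m))

  Φ∈values : ∀ 𝐯 → Φ 𝐯 ∈ values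
  Φ∈values 𝐯 = ∈-map⁺ _ (∈-cartesianProduct⁺ (∈-allVec _) (∈-allVec _))

  rank : Op22 k → ℕ
  rank 𝐯 = countBelow (Φ 𝐯) values

  -- A smaller value at 𝐭 would, inductively, be the minimum over the class of 𝐭, which contains 𝐬.
  Φ-recurrent-minimal : ∀ 𝐬 → Recurrent ω 𝐬 → MinimalAt 𝐬
  Φ-recurrent-minimal = All.wfRec (On.wellFounded rank <-wellFounded) _ _ descend
    where
    descend : ∀ 𝐬 → (∀ {𝐭} → rank 𝐭 <ℕ rank 𝐬 → Recurrent ω 𝐭 → MinimalAt 𝐭) →
              Recurrent ω 𝐬 → MinimalAt 𝐬
    descend 𝐬 ih rec 𝐭 𝐬→𝐭 with Φ 𝐬 ≤? Φ 𝐭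
    ... | yes Φ𝐬≤Φ𝐭 = Φ𝐬≤Φ𝐭
    ... | no  Φ𝐬≰Φ𝐭 = ⊥-elim (<-irrefl (sym (Φ-reach-minimal min𝐭 (rec 𝐭 𝐬→𝐭))) Φ𝐭<Φ𝐬)
      where
      Φ𝐭<Φ𝐬 : Φ 𝐭 < Φ 𝐬
      Φ𝐭<Φ𝐬 = ≰⇒> Φ𝐬≰Φ𝐭
      min𝐭 : MinimalAt 𝐭
      min𝐭 = ih (countBelow-strict Φ𝐭<Φ𝐬 (Φ∈values 𝐭)) (Recurrent-reach rec 𝐬→𝐭)

module _ {k : ℕ} (a b : Fin k) where

  -- The selector inside weightWhere is local to Defs; a singleton list exposes it per element.
  weightOf : Fin k → ℚ × Op22 k → ℚ
  weightOf c e = weightWhere a b c (e ∷ [])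

  weightWhere-sumW : ∀ c l → weightWhere a b c l ≡ sumW (weightOf c) l
  weightWhere-sumW c []      = refl
  weightWhere-sumW c (e ∷ l) with proj₁ (proj₂ e) a b ≟ c | proj₂ (proj₂ e) a b ≟ c
  ... | yes _ | yes _ = cong₂ _+_ (sym (+-identityʳ (proj₁ e))) (weightWhere-sumW c l)
  ... | yes _ | no  _ = cong (0ℚ +_) (weightWhere-sumW c l)
  ... | no  _ | _     = cong (0ℚ +_) (weightWhere-sumW c l)

  weightOf-hit : ∀ {c} e → proj₁ (proj₂ e) a b ≡ c → proj₂ (proj₂ e) a b ≡ c → weightOf c e ≡ proj₁ e
  weightOf-hit {c} (w , g₁ , g₂) g₁≡c g₂≡c with g₁ a b ≟ c | g₂ a b ≟ c
  ... | yes _     | yes _     = +-identityʳ w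
  ... | no  g₁≢c  | _         = ⊥-elim (g₁≢c g₁≡c)
  ... | yes _     | no  g₂≢c  = ⊥-elim (g₂≢c g₂≡c)

  weightOf-miss : ∀ {c} e → ¬ (proj₁ (proj₂ e) a b ≡ c × proj₂ (proj₂ e) a b ≡ c) → weightOf c e ≡ 0ℚ
  weightOf-miss {c} (w , g₁ , g₂) miss with g₁ a b ≟ c | g₂ a b ≟ c
  ... | yes g₁≡c | yes g₂≡c = ⊥-elim (miss (g₁≡c , g₂≡c))
  ... | yes _    | no  _    = refl
  ... | no  _    | _        = refl

  weightWhere-lowerBound : a ≢ b → (K : Fin k → ℚ) (T : ℚ × Op22 k → ℚ) (ρ : List (ℚ × Op22 k)) →
    (∀ {e} → e ∈ ρ → 0ℚ ≤ proj₁ e) → (∀ {e} → e ∈ ρ → 0ℚ ≤ T e) →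
    (∀ {e} c → e ∈ ρ → 0ℚ < proj₁ e → proj₁ (proj₂ e) a b ≡ c → proj₂ (proj₂ e) a b ≡ c → K c ≤ T e) →
    weightWhere a b a ρ * K a + weightWhere a b b ρ * K b ≤ sumW (λ e → proj₁ e * T e) ρ
  weightWhere-lowerBound a≢b K T ρ w≥0 T≥0 K≤T = begin
    weightWhere a b a ρ * K a + weightWhere a b b ρ * K b
      ≡⟨ cong₂ (λ s t → s * K a + t * K b) (weightWhere-sumW a ρ) (weightWhere-sumW b ρ) ⟩
    sumW (weightOf a) ρ * K a + sumW (weightOf b) ρ * K b
      ≡⟨ sym (cong₂ _+_ (sumW-*ʳ (weightOf a) (K a) ρ) (sumW-*ʳ (weightOf b) (K b) ρ)) ⟩
    sumW (λ e → weightOf a e * K a) ρ + sumW (λ e → weightOf b e * K b) ρ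
      ≡⟨ sym (sumW-+ (λ e → weightOf a e * K a) (λ e → weightOf b e * K b) ρ) ⟩
    sumW (λ e → weightOf a e * K a + weightOf b e * K b) ρ
      ≤⟨ sumW-mono ρ termwise ⟩
    sumW (λ e → proj₁ e * T e) ρ ∎
    where
    open ≤-Reasoning
    reweigh : ∀ e {s t} → weightOf a e ≡ s → weightOf b e ≡ t →
              weightOf a e * K a + weightOf b e * K b ≡ s * K a + t * K b
    reweigh e = cong₂ (λ s t → s * K a + t * K b)
    termwise : ∀ {e} → e ∈ ρ → weightOf a e * K a + weightOf b e * K b ≤ proj₁ e * T e
    termwise {e@(w , g₁ , g₂)} e∈ρ with (g₁ a b ≟ a) ×-dec (g₂ a b ≟ a) | (g₁ a b ≟ b) ×-dec (g₂ a b ≟ b)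
    ... | yes (g₁≡a , _)    | yes (g₁≡b , _)    = ⊥-elim (a≢b (trans (sym g₁≡a) g₁≡b))
    ... | yes (g₁≡a , g₂≡a) | no missᵇ = begin
      weightOf a e * K a + weightOf b e * K b
        ≡⟨ reweigh e (weightOf-hit e g₁≡a g₂≡a) (weightOf-miss e missᵇ) ⟩
      w * K a + 0ℚ * K b
        ≡⟨ solve 3 (λ w x y → w :* x :+ con 0ℚ :* y := w :* x) refl w (K a) (K b) ⟩
      w * K a
        ≤⟨ *-monoˡ-≤-onSupport w (w≥0 e∈ρ) (λ 0<w → K≤T a e∈ρ 0<w g₁≡a g₂≡a) ⟩
      w * T e ∎
    ... | no missᵃ | yes (g₁≡b , g₂≡b) = begin
      weightOf a e * K a + weightOf b e * K b
        ≡⟨ reweigh e (weightOf-miss e missᵃ) (weightOf-hit e g₁≡b g₂≡b) ⟩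
      0ℚ * K a + w * K b
        ≡⟨ solve 3 (λ w x y → con 0ℚ :* x :+ w :* y := w :* y) refl w (K a) (K b) ⟩
      w * K b
        ≤⟨ *-monoˡ-≤-onSupport w (w≥0 e∈ρ) (λ 0<w → K≤T b e∈ρ 0<w g₁≡b g₂≡b) ⟩
      w * T e ∎
    ... | no missᵃ | no missᵇ = begin
      weightOf a e * K a + weightOf b e * K b
        ≡⟨ reweigh e (weightOf-miss e missᵃ) (weightOf-miss e missᵇ) ⟩
      0ℚ * K a + 0ℚ * K b
        ≡⟨ solve 3 (λ w x y → con 0ℚ :* x :+ con 0ℚ :* y := w :* con 0ℚ) refl w (K a) (K b) ⟩
      w * 0ℚ
        ≤⟨ *-monoˡ-≤-nonNeg w {{nonNegative (w≥0 e∈ρ)}} (T≥0 e∈ρ) ⟩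
      w * T e ∎

module _ {k : ℕ} {Γ : Lang k} (Γ≥0 : NonNegLang Γ)
  {ω : List (ℚ × BOp k)} (ωFP : BinaryFP (Const Γ) ω)
  {m : ℕ} {f : Vec (Fin k) (suc m) → ℚ} (f∈Γ : Γ (suc m) f) where

  f²-nonNeg : ∀ u v → 0ℚ ≤ f² f u v
  f²-nonNeg u v = *-monoˡ-≤-nonNeg ½ (+-mono-≤ (Γ≥0 _ f f∈Γ u) (Γ≥0 _ f f∈Γ v))

  fixedHead-≤ : ∀ {𝐠 𝐡 : Op22 k} {X₁ X₂} → Recurrent ω 𝐠 → InV ω 𝐡 → InRange 𝐠 X₁ X₂ → ∀ c →
    f² f (c ∷ X₁) (c ∷ X₂) ≤ f² f (c ∷ zipWith (proj₁ 𝐡) X₁ X₂) (c ∷ zipWith (proj₂ 𝐡) X₁ X₂)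
  fixedHead-≤ {𝐠} {𝐡} 𝐠-rec 𝐡∈V (y₁ , y₂ , refl) c =
    subst₂ (λ p q → Φ 𝐠 ≤ f² f (c ∷ p) (c ∷ q))
      (zipWith-fuse (proj₁ 𝐡) (proj₁ 𝐠) (proj₂ 𝐠) y₁ y₂)
      (zipWith-fuse (proj₂ 𝐡) (proj₁ 𝐠) (proj₂ 𝐠) y₁ y₂)
      (Φ-recurrent-minimal 𝐠 𝐠-rec (𝐡 ∘₂ 𝐠) (Reach-∘₂ʳ 𝐠 𝐡∈V))
    where open Potential ω (proj₁ ωFP) (λ x → f (c ∷ x)) (BinaryFP⇒fixHead ωFP f∈Γ c) y₁ y₂

  ρ-average-≥-mean : ∀ {ρ : List (ℚ × Op22 k)} → TwoToTwoFP (Const Γ) ρ →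
    (∀ 𝐡 → InSupp22 ρ 𝐡 → InR ω 𝐡) →
    ∀ {a₁ a₂} → a₁ ≢ a₂ → SubmodularOn ρ a₁ a₂ →
    ∀ {𝐠 X₁ X₂} → InSupp22 ρ 𝐠 → InRange 𝐠 X₁ X₂ →
    ∀ {u₁ u₂} → DiagonalAgrees ω a₁ a₂ u₁ u₂ →
    ½ * (f² f (a₁ ∷ X₁) (a₂ ∷ X₂) + f² f (a₂ ∷ X₁) (a₁ ∷ X₂)) ≤ f² f (u₁ ∷ X₁) (u₂ ∷ X₂)
  ρ-average-≥-mean {ρ} ρFP supp⊆R {a₁} {a₂} a₁≢a₂ (w₁≡½ , w₂≡½) {𝐠} {X₁} {X₂} 𝐠∈ρ 𝐠-range
                   {u₁} {u₂} diagonal = begin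
    ½ * (f² f (a₁ ∷ X₁) (a₂ ∷ X₂) + f² f (a₂ ∷ X₁) (a₁ ∷ X₂))
      ≡⟨ solve 5 (λ p q r s h → h :* (h :* (p :+ s) :+ h :* (r :+ q))
                              := h :* (h :* (p :+ q)) :+ h :* (h :* (r :+ s)))
                 refl (f (a₁ ∷ X₁)) (f (a₁ ∷ X₂)) (f (a₂ ∷ X₁)) (f (a₂ ∷ X₂)) ½ ⟩
    ½ * K a₁ + ½ * K a₂
      ≡⟨ sym (cong₂ (λ s t → s * K a₁ + t * K a₂) w₁≡½ w₂≡½) ⟩
    weightWhere a₁ a₂ a₁ ρ * K a₁ + weightWhere a₁ a₂ a₂ ρ * K a₂
      ≤⟨ weightWhere-lowerBound a₁ a₂ a₁≢a₂ K T ρ (proj₁ (proj₁ ρFP)) (λ {e} _ → T≥0 e) K≤T ⟩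
    sumW (λ e → proj₁ e * T e) ρ
      ≤⟨ TwoToTwoFP⇒of ρFP f∈Γ (u₁ ∷ X₁) (u₂ ∷ X₂) ⟩
    f² f (u₁ ∷ X₁) (u₂ ∷ X₂) ∎
    where
    open ≤-Reasoning
    K : Fin k → ℚ
    K c = f² f (c ∷ X₁) (c ∷ X₂)
    T : ℚ × Op22 k → ℚ
    T (_ , h₁ , h₂) = f² f (zipWith h₁ (u₁ ∷ X₁) (u₂ ∷ X₂)) (zipWith h₂ (u₁ ∷ X₁) (u₂ ∷ X₂))
    T≥0 : ∀ e → 0ℚ ≤ T e
    T≥0 _ = f²-nonNeg _ _
    K≤T : ∀ {e} c → e ∈ ρ → 0ℚ < proj₁ e →
          proj₁ (proj₂ e) a₁ a₂ ≡ c → proj₂ (proj₂ e) a₁ a₂ ≡ c → K c ≤ T e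
    K≤T {w , 𝐡} c e∈ρ 0<w h₁≡c h₂≡c =
      subst₂ (λ s t → K c ≤ f² f (s ∷ zipWith (proj₁ 𝐡) X₁ X₂) (t ∷ zipWith (proj₂ 𝐡) X₁ X₂))
        (sym (proj₁ u-heads)) (sym (proj₂ u-heads))
        (fixedHead-≤ (proj₂ (supp⊆R 𝐠 𝐠∈ρ)) 𝐡∈V 𝐠-range c)
      where
      𝐡∈V : InV ω 𝐡
      𝐡∈V = proj₁ (supp⊆R 𝐡 (Any.map (λ { refl → 0<w , λ x y → refl , refl }) e∈ρ))
      u-heads : proj₁ 𝐡 u₁ u₂ ≡ c × proj₂ 𝐡 u₁ u₂ ≡ c
      u-heads = diagonal 𝐡∈V h₁≡c h₂≡c

lemma3p11 : ∀ {k : ℕ} (Γ : Lang k) → NonNegLang Γ → IsCore Γ → ¬ MC (Const Γ) →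
    (ω : List (ℚ × BOp k)) → BinaryFP (Const Γ) ω →
    (∀ (a b : Fin k) → a ≢ b → Σ (BOp k) λ g → InSuppB ω g × ¬ SameSet2 (g a b) (g b a) a b) →
    (ρ : List (ℚ × Op22 k)) → TwoToTwoFP (Const Γ) ρ →
    (∀ 𝐠 → InSupp22 ρ 𝐠 → InR ω 𝐠) →
    (m : ℕ) (f : Vec (Fin k) (suc m) → ℚ) → Γ (suc m) f →
    (a₁ a₂ : Fin k) → SubmodularOn ρ a₁ a₂ →
    (x₁ x₂ : Vec (Fin k) m) → (𝐠 : Op22 k) → InSupp22 ρ 𝐠 → InRange 𝐠 x₁ x₂ →
    f² f (a₁ ∷ x₁) (a₂ ∷ x₂) ≡ f² f (a₂ ∷ x₁) (a₁ ∷ x₂)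
lemma3p11 Γ Γ≥0 _ _ ω ωFP _ ρ ρFP supp⊆R m f f∈Γ a₁ a₂ submod x₁ x₂ 𝐠 𝐠∈ρ 𝐠-range with a₁ ≟ a₂
... | yes refl = refl
... | no a₁≢a₂ = mean≤both⇒≡ _ _ (mean≤ (λ _ h₁≡c h₂≡c → h₁≡c , h₂≡c)) (mean≤ DiagonalAgrees-swap)
  where
  mean≤ : ∀ {u₁ u₂} → DiagonalAgrees ω a₁ a₂ u₁ u₂ →
          ½ * (f² f (a₁ ∷ x₁) (a₂ ∷ x₂) + f² f (a₂ ∷ x₁) (a₁ ∷ x₂)) ≤ f² f (u₁ ∷ x₁) (u₂ ∷ x₂)
  mean≤ = ρ-average-≥-mean Γ≥0 ωFP f∈Γ ρFP supp⊆R a₁≢a₂ submod 𝐠∈ρ 𝐠-range
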